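{- In the system $\mathtt{IKT}_\omega$, the rule $(\exists)$ is height-preserving invertible: if $\vdash\Gamma,\exists x A$ is derivable with height $\alpha$, then $\vdash\Gamma,A(t_1/x),A(t_2/x),\ldots$ is derivable with height at most $\alpha$.
   Context: $\mathtt{IKT}_\omega$ is a one-sided (Tait-style) sequent calculus whose sequents $\vdash\Gamma$ are built from (possibly countably infinite) multisets of formulas; formulas are built from literals $P,\overline{P}$ with multiplicative conjunction $\otimes$, multiplicative disjunction $⅋$ ("par"), quantifiers $\forall,\exists$, and a truth predicate $\mathsf{T}$ with its dual $\overline{\mathsf{T}}$; $t_1,t_2,t_3,\ldots$ is an exhaustive enumeration of the terms, and $\biguplus_{i\in I}\Gamma_i$ is infinitary multiset union. Rules: initial sequents $\vdash\Gamma,P,\overline{P}$; from $\vdash\Gamma,A$ infer $\vdash\Gamma,\mathsf{T}(\ulcorner A\urcorner)$; from $\vdash\Gamma,\overline{A}$ infer $\vdash\Gamma,\overline{\mathsf{T}}(\ulcorner A\urcorner)$; from $\vdash\Gamma,A,B$ infer $\vdash\Gamma,A⅋B$; from $\vdash\Gamma,A$ and $\vdash\Delta,B$ infer $\vdash\Gamma,\Delta,A\otimes B$; $(\forall)$: from premises $\vdash\Gamma_i,A(t_i/x)$ for every $i$ infer $\vdash\biguplus_{i\in I}\Gamma_i,\forall x A$; $(\exists)$: from $\vdash\Gamma,A(t_1/x),A(t_2/x),\ldots$ infer $\vdash\Gamma,\exists x A$. Derivations are well-founded, possibly infinitely branching trees; heights are ordinals, the height of each premise being strictly less than that of the conclusion.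 -}

module Defs where

open import Data.Nat using (ℕ; _≟_)
open import Data.Sum using (_⊎_; inj₁; inj₂; [_,_])
open import Data.Unit using (⊤; tt)
open import Data.Product using (Σ; ∃; _,_)
open import Relation.Nullary using (yes; no)
open import Relation.Binary.PropositionalEquality using (_≡_)
open import Function.Bundles using (_↔_; Inverse)

-- Brouwer tree ordinals (heights of ω-branching derivations)
-- Order as in Kraus, Nordvall Forsberg, Xu ("Type-theoretic approaches
-- to ordinals"): the least preorder generated by the constructors.

data Ord : Set where
  oz  : Ord
  os  : Ord → Ord
  lim : (ℕ → Ord) → Ord

data _≤ₒ_ : Ord → Ord → Set where
  ≤-zero     : ∀ {a} → oz ≤ₒ a
  ≤-trans    : ∀ {a b c} → a ≤ₒ b → b ≤ₒ c → a ≤ₒ c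
  ≤-succ     : ∀ {a b} → a ≤ₒ b → os a ≤ₒ os b
  ≤-cocone   : ∀ {a f} k → a ≤ₒ f k → a ≤ₒ lim f
  ≤-limiting : ∀ {a f} → (∀ k → f k ≤ₒ a) → lim f ≤ₒ a

_<ₒ_ : Ord → Ord → Set
a <ₒ b = os a ≤ₒ b

data CTerm : Set where
  czero : CTerm
  csuc  : CTerm → CTerm
  cadd  : CTerm → CTerm → CTerm
  cmul  : CTerm → CTerm → CTerm

data Term : Set where
  var  : ℕ → Term
  zer  : Term
  suc  : Term → Term
  add  : Term → Term → Term
  mul  : Term → Term → Term

embed : CTerm → Term
embed czero      = zer
embed (csuc s)   = suc (embed s)
embed (cadd s u) = add (embed s) (embed u)
embed (cmul s u) = mul (embed s) (embed u)

-- Formulas in negation normal form.  Literals: R(s,u) and its dual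
-- R̄(s,u) for binary relation symbols R (indexed by ℕ).
data Formula : Set where
  pos  : ℕ → Term → Term → Formula
  neg  : ℕ → Term → Term → Formula
  T    : Term → Formula
  Tbar : Term → Formula
  _⊗_  : Formula → Formula → Formula
  _⅋_  : Formula → Formula → Formula
  all  : ℕ → Formula → Formula
  ex   : ℕ → Formula → Formula

dual : Formula → Formula
dual (pos r s u) = neg r s u
dual (neg r s u) = pos r s u
dual (T s)       = Tbar s
dual (Tbar s)    = T s
dual (A ⊗ B)     = dual A ⅋ dual B
dual (A ⅋ B)     = dual A ⊗ dual B
dual (all x A)   = ex x (dual A)
dual (ex x A)    = all x (dual A)

-- substitution of a closed term for the variable x  (no capture possible)
substT : Term → ℕ → CTerm → Term
substT (var y) x c with y ≟ x
... | yes _ = embed c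
... | no  _ = var y
substT zer       x c = zer
substT (suc s)   x c = suc (substT s x c)
substT (add s u) x c = add (substT s x c) (substT u x c)
substT (mul s u) x c = mul (substT s x c) (substT u x c)

_[_/_] : Formula → CTerm → ℕ → Formula
pos r s u [ c / x ] = pos r (substT s x c) (substT u x c)
neg r s u [ c / x ] = neg r (substT s x c) (substT u x c)
T s       [ c / x ] = T (substT s x c)
Tbar s    [ c / x ] = Tbar (substT s x c)
(A ⊗ B)   [ c / x ] = (A [ c / x ]) ⊗ (B [ c / x ])
(A ⅋ B)   [ c / x ] = (A [ c / x ]) ⅋ (B [ c / x ])
all y A   [ c / x ] with y ≟ x
... | yes _ = all y A
... | no  _ = all y (A [ c / x ])
ex y A    [ c / x ] with y ≟ x
... | yes _ = ex y A
... | no  _ = ex y (A [ c / x ])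

-- Sequents: (possibly infinite) multisets of formulas, represented as
-- families indexed by a type; multiset equality = bijection of indices
-- respecting the formulas.

record Sequent : Set₁ where
  constructor mk
  field
    Idx : Set
    fm  : Idx → Formula
open Sequent public

Countable : Sequent → Set
Countable Γ = Σ (Idx Γ → ℕ) λ f → ∀ {i j} → f i ≡ f j → i ≡ j

_≈ₘ_ : Sequent → Sequent → Set
Γ ≈ₘ Δ = Σ (Idx Γ ↔ Idx Δ) λ e → ∀ i → fm Δ (Inverse.to e i) ≡ fm Γ i

_,,_ : Sequent → Formula → Sequent
Γ ,, A = mk (Idx Γ ⊎ ⊤) [ fm Γ , (λ _ → A) ]

_++ₘ_ : Sequent → Sequent → Sequent
Γ ++ₘ Δ = mk (Idx Γ ⊎ Idx Δ) [ fm Γ , fm Δ ]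

⋃ : (ℕ → Sequent) → Sequent
⋃ Γ = mk (Σ ℕ λ i → Idx (Γ i)) (λ { (i , j) → fm (Γ i) j })

module _ (t : ℕ → CTerm) where
  _,ω_/_ : Sequent → Formula → ℕ → Sequent
  Γ ,ω A / x = mk (Idx Γ ⊎ ℕ) [ fm Γ , (λ i → A [ t i / x ]) ]

Exhaustive : (ℕ → CTerm) → Set
Exhaustive t = ∀ c → ∃ λ i → t i ≡ c

-- The calculus IKT_ω, relative to an enumeration t of the terms and a
-- coding ⌜_⌝ of formulas by closed terms.
-- α ⊢ Γ : Γ is derivable with height ≤ α (every premise of a rule has a
-- height strictly below that of its conclusion).  Each rule concludes any
-- sequent equal, as a multiset, to the displayed conclusion.

module IKT (t : ℕ → CTerm) (⌜_⌝ : Formula → CTerm) where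

  data _⊢_ : Ord → Sequent → Set₁ where
    init : ∀ {α Γ} (Δ : Sequent) r s u →
           Γ ≈ₘ ((Δ ,, pos r s u) ,, neg r s u) → α ⊢ Γ
    rT   : ∀ {α β Γ} (Δ : Sequent) A → β <ₒ α → β ⊢ (Δ ,, A) →
           Γ ≈ₘ (Δ ,, T (embed ⌜ A ⌝)) → α ⊢ Γ
    rTbar : ∀ {α β Γ} (Δ : Sequent) A → β <ₒ α → β ⊢ (Δ ,, dual A) →
           Γ ≈ₘ (Δ ,, Tbar (embed ⌜ A ⌝)) → α ⊢ Γ
    r⅋   : ∀ {α β Γ} (Δ : Sequent) A B → β <ₒ α → β ⊢ ((Δ ,, A) ,, B) →
           Γ ≈ₘ (Δ ,, (A ⅋ B)) → α ⊢ Γ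
    r⊗   : ∀ {α β₁ β₂ Γ} (Δ₁ Δ₂ : Sequent) A B → β₁ <ₒ α → β₂ <ₒ α →
           β₁ ⊢ (Δ₁ ,, A) → β₂ ⊢ (Δ₂ ,, B) →
           Γ ≈ₘ ((Δ₁ ++ₘ Δ₂) ,, (A ⊗ B)) → α ⊢ Γ
    r∀   : ∀ {α Γ} (Δ : ℕ → Sequent) x A (β : ℕ → Ord) →
           (∀ i → β i <ₒ α) → (∀ i → β i ⊢ (Δ i ,, (A [ t i / x ]))) →
           Γ ≈ₘ (⋃ Δ ,, all x A) → α ⊢ Γ
    r∃   : ∀ {α β Γ} (Δ : Sequent) x A → β <ₒ α → β ⊢ (_,ω_/_ t Δ A x) →
           Γ ≈ₘ (Δ ,, ex x A) → α ⊢ Γ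

{-# OPTIONS --safe #-}
module Submission where

-- An occurrence of ∃x A cannot simply be traced up a derivation: removing it from
-- the context of a rule would need decidable equality on arbitrary index types.
-- So we prove more: replacing any family of occurrences of ∃x A in a derivable
-- sequent by all their instances A(tᵢ/x) (a multiset bind) keeps it derivable at
-- the same height.  By induction on the derivation the replacement is transported
-- along each rule's multiset equality into its premises; when a replaced occurrence
-- is principal in an (∃)-rule, the rebuilt premise is itself the goal, and its
-- height lies below that of the conclusion.

open import Defs
open import Level using (0ℓ)
open import Data.Nat using (ℕ)
open import Data.Sum using (_⊎_; inj₁; inj₂; [_,_])
open import Data.Sum.Function.Propositional using (_⊎-↔_)
open import Data.Unit using (⊤; tt)
open import Data.Product using (Σ; _,_; proj₁; proj₂; _×_)
open import Function using (_∘_)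
open import Function.Bundles using (_↔_; Inverse; mk↔ₛ′)
open import Function.Properties.Inverse using (↔-refl; ↔-sym; ↔-trans)
open import Relation.Binary.Bundles using (Setoid)
open import Relation.Binary.PropositionalEquality using (_≡_; _≢_; refl; sym; trans; cong; subst)
open import Relation.Nullary using (contradiction)
import Relation.Binary.Reasoning.Setoid as SetoidReasoning

≤ₒ-refl : ∀ a → a ≤ₒ a
≤ₒ-refl oz      = ≤-zero
≤ₒ-refl (os a)  = ≤-succ (≤ₒ-refl a)
≤ₒ-refl (lim f) = ≤-limiting (λ k → ≤-cocone k (≤ₒ-refl (f k)))

a≤ₒos-a : ∀ a → a ≤ₒ os a
a≤ₒos-a oz      = ≤-zero
a≤ₒos-a (os a)  = ≤-succ (a≤ₒos-a a)
a≤ₒos-a (lim f) = ≤-limiting λ k →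
  ≤-trans (a≤ₒos-a (f k)) (≤-succ (≤-cocone k (≤ₒ-refl (f k))))

<ₒ⇒≤ₒ : ∀ {a b} → a <ₒ b → a ≤ₒ b
<ₒ⇒≤ₒ {a} a<b = ≤-trans (a≤ₒos-a a) a<b

≈ₘ-refl : ∀ {Γ} → Γ ≈ₘ Γ
≈ₘ-refl = ↔-refl , λ _ → refl

≈ₘ-sym : ∀ {Γ Δ} → Γ ≈ₘ Δ → Δ ≈ₘ Γ
≈ₘ-sym {Δ = Δ} (e , p) = ↔-sym e , λ j →
  trans (sym (p (from j))) (cong (fm Δ) (strictlyInverseˡ j))
  where open Inverse e

≈ₘ-trans : ∀ {Γ Δ Θ} → Γ ≈ₘ Δ → Δ ≈ₘ Θ → Γ ≈ₘ Θ
≈ₘ-trans (e , p) (e′ , p′) = ↔-trans e e′ , λ i → trans (p′ (Inverse.to e i)) (p i)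

≈ₘ-setoid : Setoid _ 0ℓ
≈ₘ-setoid = record
  { Carrier       = Sequent
  ; _≈_           = _≈ₘ_
  ; isEquivalence = record
    { refl  = ≈ₘ-refl
    ; sym   = ≈ₘ-sym
    ; trans = λ {Γ Δ Θ} → ≈ₘ-trans {Γ} {Δ} {Θ}
    }
  }

open SetoidReasoning ≈ₘ-setoid

++ₘ-cong : ∀ {Γ Γ′ Δ Δ′} → Γ ≈ₘ Γ′ → Δ ≈ₘ Δ′ → (Γ ++ₘ Δ) ≈ₘ (Γ′ ++ₘ Δ′)
++ₘ-cong (e , p) (e′ , p′) = (e ⊎-↔ e′) , λ { (inj₁ i) → p i ; (inj₂ j) → p′ j }

++ₘ-congˡ : ∀ {Γ Γ′ Δ} → Γ ≈ₘ Γ′ → (Γ ++ₘ Δ) ≈ₘ (Γ′ ++ₘ Δ)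
++ₘ-congˡ Γ≈Γ′ = ++ₘ-cong Γ≈Γ′ ≈ₘ-refl

-- Stated for the unfolded Σ-type so that Agda can infer the indices from the argument.
≈ₘ-from : ∀ {I J : Set} {Q : I ↔ J → Set} → Σ (I ↔ J) Q → J → I
≈ₘ-from = Inverse.from ∘ proj₁

[_]ₘ : Formula → Sequent
[ A ]ₘ = mk ⊤ λ _ → A

infix 5 _>>=ₘ_

_>>=ₘ_ : (Γ : Sequent) → (Idx Γ → Sequent) → Sequent
Γ >>=ₘ P = mk (Σ (Idx Γ) (Idx ∘ P)) λ (i , j) → fm (P i) j

>>=ₘ-identityˡ : ∀ A (P : ⊤ → Sequent) → ([ A ]ₘ >>=ₘ P) ≈ₘ P tt
>>=ₘ-identityˡ A P = mk↔ₛ′ proj₂ (tt ,_) (λ _ → refl) (λ _ → refl) , λ _ → refl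

>>=ₘ-identityʳ : ∀ Γ → (Γ >>=ₘ λ i → [ fm Γ i ]ₘ) ≈ₘ Γ
>>=ₘ-identityʳ Γ = mk↔ₛ′ proj₁ (_, tt) (λ _ → refl) (λ _ → refl) , λ _ → refl

>>=ₘ-++ : ∀ Γ Δ (P : Idx Γ ⊎ Idx Δ → Sequent) →
          ((Γ ++ₘ Δ) >>=ₘ P) ≈ₘ ((Γ >>=ₘ P ∘ inj₁) ++ₘ (Δ >>=ₘ P ∘ inj₂))
>>=ₘ-++ Γ Δ P =
  mk↔ₛ′ (λ { (inj₁ i , n) → inj₁ (i , n) ; (inj₂ j , n) → inj₂ (j , n) })
        [ (λ (i , n) → inj₁ i , n) , (λ (j , n) → inj₂ j , n) ]
        (λ { (inj₁ _) → refl ; (inj₂ _) → refl })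
        (λ { (inj₁ _ , _) → refl ; (inj₂ _ , _) → refl })
  , λ { (inj₁ _ , _) → refl ; (inj₂ _ , _) → refl }

>>=ₘ-⋃ : ∀ (Γ : ℕ → Sequent) (P : Idx (⋃ Γ) → Sequent) →
         (⋃ Γ >>=ₘ P) ≈ₘ ⋃ (λ k → Γ k >>=ₘ λ i → P (k , i))
>>=ₘ-⋃ Γ P =
  mk↔ₛ′ (λ ((k , i) , n) → k , i , n) (λ (k , i , n) → (k , i) , n)
        (λ _ → refl) (λ _ → refl)
  , λ _ → refl

>>=ₘ-keep : ∀ Γ Δ (P : Idx Γ → Sequent) →
            ((Γ ++ₘ Δ) >>=ₘ [ P , (λ j → [ fm Δ j ]ₘ) ]) ≈ₘ ((Γ >>=ₘ P) ++ₘ Δ)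
>>=ₘ-keep Γ Δ P = begin
  (Γ ++ₘ Δ) >>=ₘ [ P , (λ j → [ fm Δ j ]ₘ) ]
    ≈⟨ >>=ₘ-++ Γ Δ _ ⟩
  (Γ >>=ₘ P) ++ₘ (Δ >>=ₘ λ j → [ fm Δ j ]ₘ)
    ≈⟨ ++ₘ-cong ≈ₘ-refl (>>=ₘ-identityʳ Δ) ⟩
  (Γ >>=ₘ P) ++ₘ Δ ∎

private
  ,-subst : ∀ {X Y : Set} {Q : X → Set} (f : Y → X) {a b} → a ≡ b →
            (q : f a ≡ f b) (n : Q (f b)) →
            _≡_ {A = Σ Y (Q ∘ f)} (a , subst Q (sym q) n) (b , n)
  ,-subst f refl refl n = refl

  fm-subst : ∀ {X : Set} (P : X → Sequent) {a b} (q : a ≡ b) (n : Idx (P b)) →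
             fm (P a) (subst (Idx ∘ P) (sym q) n) ≡ fm (P b) n
  fm-subst P refl n = refl

>>=ₘ-reindex : ∀ {Γ Δ} (e : Γ ≈ₘ Δ) (P : Idx Γ → Sequent) →
               (Γ >>=ₘ P) ≈ₘ (Δ >>=ₘ P ∘ ≈ₘ-from e)
>>=ₘ-reindex (e , _) P =
  mk↔ₛ′ (λ (i , n) → to i , subst (Idx ∘ P) (sym (strictlyInverseʳ i)) n)
        (λ (j , n) → from j , n)
        (λ (j , n) → ,-subst from (strictlyInverseˡ j) (strictlyInverseʳ (from j)) n)
        (λ (i , n) → ,-subst (λ i → i) (strictlyInverseʳ i) (strictlyInverseʳ i) n)
  , λ (i , n) → fm-subst P (strictlyInverseʳ i) n
  where open Inverse e

>>=ₘ-,, : ∀ Γ A {Δ} (P : Idx (Γ ,, A) → Sequent) → P (inj₂ tt) ≈ₘ Δ →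
         ((Γ ,, A) >>=ₘ P) ≈ₘ ((Γ >>=ₘ P ∘ inj₁) ++ₘ Δ)
>>=ₘ-,, Γ A {Δ} P h = begin
  (Γ ++ₘ [ A ]ₘ) >>=ₘ P                          ≈⟨ >>=ₘ-++ Γ [ A ]ₘ P ⟩
  (Γ >>=ₘ P ∘ inj₁) ++ₘ ([ A ]ₘ >>=ₘ P ∘ inj₂)  ≈⟨ ++ₘ-cong ≈ₘ-refl (>>=ₘ-identityˡ A (P ∘ inj₂)) ⟩
  (Γ >>=ₘ P ∘ inj₁) ++ₘ P (inj₂ tt)             ≈⟨ ++ₘ-cong ≈ₘ-refl h ⟩
  (Γ >>=ₘ P ∘ inj₁) ++ₘ Δ                       ∎

>>=ₘ-split : ∀ {Θ Γ A Δ} (e : Θ ≈ₘ (Γ ,, A)) (P : Idx Θ → Sequent) →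
             P (≈ₘ-from e (inj₂ tt)) ≈ₘ Δ →
             (Θ >>=ₘ P) ≈ₘ ((Γ >>=ₘ P ∘ ≈ₘ-from e ∘ inj₁) ++ₘ Δ)
>>=ₘ-split {Θ} {Γ} {A} {Δ} e P h = begin
  Θ >>=ₘ P                                 ≈⟨ >>=ₘ-reindex {Δ = Γ ,, A} e P ⟩
  (Γ ,, A) >>=ₘ P ∘ ≈ₘ-from e              ≈⟨ >>=ₘ-,, Γ A (P ∘ ≈ₘ-from e) h ⟩
  (Γ >>=ₘ P ∘ ≈ₘ-from e ∘ inj₁) ++ₘ Δ      ∎

module Inversion (t : ℕ → CTerm) (⌜_⌝ : Formula → CTerm) where
  open IKT t ⌜_⌝

  ⊢-resp-≈ₘ : ∀ {α Γ Δ} → Γ ≈ₘ Δ → α ⊢ Γ → α ⊢ Δ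
  ⊢-resp-≈ₘ Γ≈Δ (init Θ r s u e) =
    init Θ r s u (≈ₘ-trans {Θ = (Θ ,, pos r s u) ,, neg r s u} (≈ₘ-sym Γ≈Δ) e)
  ⊢-resp-≈ₘ Γ≈Δ (rT Θ A lt d e) =
    rT Θ A lt d (≈ₘ-trans {Θ = Θ ,, T (embed ⌜ A ⌝)} (≈ₘ-sym Γ≈Δ) e)
  ⊢-resp-≈ₘ Γ≈Δ (rTbar Θ A lt d e) =
    rTbar Θ A lt d (≈ₘ-trans {Θ = Θ ,, Tbar (embed ⌜ A ⌝)} (≈ₘ-sym Γ≈Δ) e)
  ⊢-resp-≈ₘ Γ≈Δ (r⅋ Θ A B lt d e) =
    r⅋ Θ A B lt d (≈ₘ-trans {Θ = Θ ,, (A ⅋ B)} (≈ₘ-sym Γ≈Δ) e)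
  ⊢-resp-≈ₘ Γ≈Δ (r⊗ Θ₁ Θ₂ A B lt₁ lt₂ d₁ d₂ e) =
    r⊗ Θ₁ Θ₂ A B lt₁ lt₂ d₁ d₂ (≈ₘ-trans {Θ = (Θ₁ ++ₘ Θ₂) ,, (A ⊗ B)} (≈ₘ-sym Γ≈Δ) e)
  ⊢-resp-≈ₘ Γ≈Δ (r∀ Θ y A β lt d e) =
    r∀ Θ y A β lt d (≈ₘ-trans {Θ = ⋃ Θ ,, all y A} (≈ₘ-sym Γ≈Δ) e)
  ⊢-resp-≈ₘ Γ≈Δ (r∃ Θ y A lt d e) =
    r∃ Θ y A lt d (≈ₘ-trans {Θ = Θ ,, ex y A} (≈ₘ-sym Γ≈Δ) e)

  ⊢-mono : ∀ {α β Γ} → α ≤ₒ β → α ⊢ Γ → β ⊢ Γ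
  ⊢-mono α≤β (init Θ r s u e)                = init Θ r s u e
  ⊢-mono α≤β (rT Θ A lt d e)                 = rT Θ A (≤-trans lt α≤β) d e
  ⊢-mono α≤β (rTbar Θ A lt d e)              = rTbar Θ A (≤-trans lt α≤β) d e
  ⊢-mono α≤β (r⅋ Θ A B lt d e)               = r⅋ Θ A B (≤-trans lt α≤β) d e
  ⊢-mono α≤β (r⊗ Θ₁ Θ₂ A B lt₁ lt₂ d₁ d₂ e)  =
    r⊗ Θ₁ Θ₂ A B (≤-trans lt₁ α≤β) (≤-trans lt₂ α≤β) d₁ d₂ e
  ⊢-mono α≤β (r∀ Θ y A β lt d e)             = r∀ Θ y A β (λ i → ≤-trans (lt i) α≤β) d e
  ⊢-mono α≤β (r∃ Θ y A lt d e)               = r∃ Θ y A (≤-trans lt α≤β) d e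

  module _ (x : ℕ) (A : Formula) where

    instances : Sequent
    instances = mk ℕ λ i → A [ t i / x ]

    Unfolds : (Γ : Sequent) → (Idx Γ → Sequent) → Set
    Unfolds Γ P = ∀ i → P i ≈ₘ [ fm Γ i ]ₘ ⊎ (fm Γ i ≡ ex x A × P i ≈ₘ instances)

    Unfolds-reindex : ∀ {Γ Δ} (e : Γ ≈ₘ Δ) (P : Idx Γ → Sequent) →
                      Unfolds Γ P → Unfolds Δ (P ∘ ≈ₘ-from e)
    Unfolds-reindex e P G j with G (≈ₘ-from e j)
    ... | inj₁ h         = inj₁ (subst (λ B → P (≈ₘ-from e j) ≈ₘ [ B ]ₘ) (proj₂ (≈ₘ-sym e) j) h)
    ... | inj₂ (Γj≡∃ , h) = inj₂ (trans (sym (proj₂ (≈ₘ-sym e) j)) Γj≡∃ , h)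

    Unfolds-keep : ∀ {Γ Δ} {P : Idx Γ → Sequent} →
                   Unfolds Γ P → Unfolds (Γ ++ₘ Δ) [ P , (λ j → [ fm Δ j ]ₘ) ]
    Unfolds-keep G (inj₁ i) = G i
    Unfolds-keep G (inj₂ j) = inj₁ ≈ₘ-refl

    Unfolds-principal : ∀ {Γ B} {P : Idx (Γ ,, B) → Sequent} →
                        Unfolds (Γ ,, B) P → B ≢ ex x A → P (inj₂ tt) ≈ₘ [ B ]ₘ
    Unfolds-principal G B≢∃ with G (inj₂ tt)
    ... | inj₁ h          = h
    ... | inj₂ (B≡∃ , _)  = contradiction B≡∃ B≢∃

    mutual
      ⊢-unfold : ∀ {α Γ} → α ⊢ Γ → (P : Idx Γ → Sequent) → Unfolds Γ P → α ⊢ (Γ >>=ₘ P)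
      ⊢-unfold {Γ = Γ} (init Θ r s u e) P G =
        init (Θ >>=ₘ P′ ∘ inj₁ ∘ inj₁) r s u (begin
          Γ >>=ₘ P
            ≈⟨ >>=ₘ-split e P (Unfolds-principal G′ λ ()) ⟩
          ((Θ ,, pos r s u) >>=ₘ P′ ∘ inj₁) ,, neg r s u
            ≈⟨ ++ₘ-congˡ (>>=ₘ-,, Θ (pos r s u) (P′ ∘ inj₁) (Unfolds-principal (G′ ∘ inj₁) λ ())) ⟩
          ((Θ >>=ₘ P′ ∘ inj₁ ∘ inj₁) ,, pos r s u) ,, neg r s u ∎)
        where
        P′ : Idx ((Θ ,, pos r s u) ,, neg r s u) → Sequent
        P′ = P ∘ ≈ₘ-from e
        G′ : Unfolds ((Θ ,, pos r s u) ,, neg r s u) P′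
        G′ = Unfolds-reindex e P G
      ⊢-unfold (rT Θ B lt d e) P G =
        rT _ B lt (⊢-unfold-context d _ (G′ ∘ inj₁)) (>>=ₘ-split e P (Unfolds-principal G′ λ ()))
        where
        G′ : Unfolds (Θ ,, T (embed ⌜ B ⌝)) (P ∘ ≈ₘ-from e)
        G′ = Unfolds-reindex e P G
      ⊢-unfold (rTbar Θ B lt d e) P G =
        rTbar _ B lt (⊢-unfold-context d _ (G′ ∘ inj₁)) (>>=ₘ-split e P (Unfolds-principal G′ λ ()))
        where
        G′ : Unfolds (Θ ,, Tbar (embed ⌜ B ⌝)) (P ∘ ≈ₘ-from e)
        G′ = Unfolds-reindex e P G
      ⊢-unfold (r⅋ Θ B C lt d e) P G =
        r⅋ _ B C lt
           (⊢-resp-≈ₘ (++ₘ-congˡ (>>=ₘ-keep Θ [ B ]ₘ (P′ ∘ inj₁)))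
              (⊢-unfold-context d _ (Unfolds-keep (G′ ∘ inj₁))))
           (>>=ₘ-split e P (Unfolds-principal G′ λ ()))
        where
        P′ : Idx (Θ ,, (B ⅋ C)) → Sequent
        P′ = P ∘ ≈ₘ-from e
        G′ : Unfolds (Θ ,, (B ⅋ C)) P′
        G′ = Unfolds-reindex e P G
      ⊢-unfold {Γ = Γ} (r⊗ Θ₁ Θ₂ B C lt₁ lt₂ d₁ d₂ e) P G =
        r⊗ _ _ B C lt₁ lt₂
           (⊢-unfold-context d₁ _ (G′ ∘ inj₁ ∘ inj₁))
           (⊢-unfold-context d₂ _ (G′ ∘ inj₁ ∘ inj₂)) (begin
             Γ >>=ₘ P
               ≈⟨ >>=ₘ-split e P (Unfolds-principal G′ λ ()) ⟩
             ((Θ₁ ++ₘ Θ₂) >>=ₘ P′ ∘ inj₁) ,, (B ⊗ C)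
               ≈⟨ ++ₘ-congˡ (>>=ₘ-++ Θ₁ Θ₂ (P′ ∘ inj₁)) ⟩
             ((Θ₁ >>=ₘ P′ ∘ inj₁ ∘ inj₁) ++ₘ (Θ₂ >>=ₘ P′ ∘ inj₁ ∘ inj₂)) ,, (B ⊗ C) ∎)
        where
        P′ : Idx ((Θ₁ ++ₘ Θ₂) ,, (B ⊗ C)) → Sequent
        P′ = P ∘ ≈ₘ-from e
        G′ : Unfolds ((Θ₁ ++ₘ Θ₂) ,, (B ⊗ C)) P′
        G′ = Unfolds-reindex e P G
      ⊢-unfold {Γ = Γ} (r∀ Θ y B β lt d e) P G =
        r∀ _ y B β lt (λ k → ⊢-unfold-context (d k) _ (λ i → G′ (inj₁ (k , i)))) (begin
          Γ >>=ₘ P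
            ≈⟨ >>=ₘ-split e P (Unfolds-principal G′ λ ()) ⟩
          (⋃ Θ >>=ₘ P′ ∘ inj₁) ,, all y B
            ≈⟨ ++ₘ-congˡ (>>=ₘ-⋃ Θ (P′ ∘ inj₁)) ⟩
          ⋃ (λ k → Θ k >>=ₘ λ i → P′ (inj₁ (k , i))) ,, all y B ∎)
        where
        P′ : Idx (⋃ Θ ,, all y B) → Sequent
        P′ = P ∘ ≈ₘ-from e
        G′ : Unfolds (⋃ Θ ,, all y B) P′
        G′ = Unfolds-reindex e P G
      ⊢-unfold (r∃ Θ y B lt d e) P G with Unfolds-reindex {Δ = Θ ,, ex y B} e P G (inj₂ tt)
      ... | inj₁ h =
        r∃ _ y B lt (⊢-unfold-context d _ (Unfolds-reindex {Δ = Θ ,, ex y B} e P G ∘ inj₁))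
           (>>=ₘ-split e P h)
      ... | inj₂ (refl , h) =
        ⊢-mono (<ₒ⇒≤ₒ lt)
          (⊢-resp-≈ₘ (≈ₘ-sym (>>=ₘ-split e P h))
            (⊢-unfold-context d _ (Unfolds-reindex {Δ = Θ ,, ex x A} e P G ∘ inj₁)))

      ⊢-unfold-context : ∀ {α Γ Δ} → α ⊢ (Γ ++ₘ Δ) → (P : Idx Γ → Sequent) → Unfolds Γ P →
                         α ⊢ ((Γ >>=ₘ P) ++ₘ Δ)
      ⊢-unfold-context {Γ = Γ} {Δ} d P G =
        ⊢-resp-≈ₘ (>>=ₘ-keep Γ Δ P) (⊢-unfold d _ (Unfolds-keep G))

    ∃-inversion : ∀ {α Γ} → α ⊢ (Γ ,, ex x A) → α ⊢ (Γ ++ₘ instances)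
    ∃-inversion {Γ = Γ} d = ⊢-resp-≈ₘ unfolded (⊢-unfold d P G)
      where
      P : Idx (Γ ,, ex x A) → Sequent
      P = [ (λ i → [ fm Γ i ]ₘ) , (λ _ → instances) ]
      G : Unfolds (Γ ,, ex x A) P
      G (inj₁ i) = inj₁ ≈ₘ-refl
      G (inj₂ _) = inj₂ (refl , ≈ₘ-refl)
      unfolded : ((Γ ,, ex x A) >>=ₘ P) ≈ₘ (Γ ++ₘ instances)
      unfolded = begin
        (Γ ,, ex x A) >>=ₘ P                          ≈⟨ >>=ₘ-,, Γ (ex x A) P ≈ₘ-refl ⟩
        (Γ >>=ₘ λ i → [ fm Γ i ]ₘ) ++ₘ instances      ≈⟨ ++ₘ-congˡ (>>=ₘ-identityʳ Γ) ⟩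
        Γ ++ₘ instances                               ∎

mainTheorem1 : (t : ℕ → CTerm) → Exhaustive t → (⌜_⌝ : Formula → CTerm) →
    (α : Ord) (Γ : Sequent) → Countable Γ → (x : ℕ) (A : Formula) →
    IKT._⊢_ t ⌜_⌝ α (Γ ,, ex x A) →
    IKT._⊢_ t ⌜_⌝ α (_,ω_/_ t Γ A x)
mainTheorem1 t _ ⌜_⌝ _ _ _ x A = Inversion.∃-inversion t ⌜_⌝ x A
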